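{- Let $\mathcal{A}=\mathbb{F}_q^s\times(\mathbb{F}_q^\ast)^{m-s}$ and let $L$ be a set of monomials in $\mathbb{F}_q[x_1,\ldots,x_m]$ with $\deg_{x_i}u<q$ for $i\le s$ and $\deg_{x_i}u<q-1$ for $i>s$ for every $u\in L$, such that $L$ is closed under divisibility and has the Borel property. Then an affine transformation $T(x)=Ax+b$ lies in $\mathrm{Perm}_A(L(\mathcal{A}))$ if $A=\begin{pmatrix} A_1 & 0\\ 0 & I_{m-s}\end{pmatrix}$, where $A_1$ is a nonsingular lower triangular $s\times s$ matrix, $I_{m-s}$ is the identity matrix of size $m-s$, and $b\in\mathbb{F}_q^m$ satisfies $b_i=0$ for $i>s$.
   Context: For a Cartesian set $\mathcal{A}=\prod_{i=1}^m A_i$ with $A_i\subseteq\mathbb{F}_q$, $n_i=|A_i|\ge 2$, let $\Delta$ be the set of monomials $u$ with $\deg_{x_i}u<n_i$; for $L\subseteq\Delta$, $L(\mathcal{A})=\mathrm{Span}_{\mathbb{F}_q}\{(f(P_1),\ldots,f(P_n)) : f\in L\}$ where $\mathcal{A}=\{P_1,\ldots,P_n\}$. $I_{\mathcal{A}}=\left(\prod_{\alpha\in A_j}(x_j-\alpha)\right)_{j=1}^m$ and $\overline{g}$ is the unique element of $\mathrm{Span}_{\mathbb{F}_q}(\Delta)$ with $g-\overline{g}\in I_{\mathcal{A}}$. An affine transformation $T(x)=Ax+b$ acts on points by $P\mapsto AP+b$ and on polynomials by $T(f)=f(y_1,\ldots,y_m)$, $(y_1,\ldots,y_m)^t=A(x_1,\ldots,x_m)^t+b$.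 $T\in\mathrm{Perm}_A(L(\mathcal{A}))$ means $T(\mathcal{A})=\mathcal{A}$ and $\overline{T(f)}\in\mathrm{Span}_{\mathbb{F}_q}(L)$ for all $f\in L$. $L$ has the Borel property if $u\in L$, $x_i\mid u$, $j<i$ imply $\frac{x_j}{x_i}u\in L$. -}

module Defs where

open import Level using (Level; _⊔_) renaming (suc to lsuc)
open import Data.Nat as ℕ using (ℕ; zero; suc; _<_; _≤_; _∸_)
open import Data.Fin as Fin using (Fin; toℕ; splitAt; _↑ˡ_; _↑ʳ_)
open import Data.Fin.Properties using () renaming (_≟_ to _≟ᶠ_)
open import Data.Vec as Vec using (Vec; replicate; zipWith; lookup; updateAt)
open import Data.Vec.Properties using (≡-dec)
open import Data.List as List using (List; []; _∷_; _++_; map; concatMap; foldr; filter; allFin)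
open import Data.List.Relation.Unary.Any using (Any)
open import Data.Product using (Σ; ∃; _×_; _,_; proj₁; proj₂)
open import Data.Sum using (inj₁; inj₂)
open import Relation.Nullary using (¬_; Dec; yes; no)
open import Relation.Nullary.Decidable using (does)
open import Relation.Unary using (Pred)
open import Relation.Binary using (Decidable)
open import Relation.Binary.PropositionalEquality using (_≡_)
open import Algebra.Bundles using (CommutativeRing)
open import Function.Definitions using (Injective; Surjective)

record FiniteField (c ℓ : Level) : Set (lsuc (c ⊔ ℓ)) where
  field
    commRing : CommutativeRing c ℓ
  open CommutativeRing commRing public
  field
    _≟_      : Decidable _≈_
    0≉1      : ¬ (0# ≈ 1#)
    inverse  : ∀ x → ¬ (x ≈ 0#) → ∃ λ y → x * y ≈ 1#
    q        : ℕ
    enum     : Fin q → Carrier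
    enum-inj : Injective _≡_ _≈_ enum
    enum-sur : Surjective _≡_ _≈_ enum

module Over {c ℓ : Level} (F : FiniteField c ℓ) where
  open FiniteField F

  ∑ : ∀ {n} → (Fin n → Carrier) → Carrier
  ∑ {n} f = foldr (λ i acc → f i + acc) 0# (allFin n)

  Mon : ℕ → Set
  Mon m = Vec ℕ m

  Poly : ℕ → Set c
  Poly m = List (Carrier × Mon m)

  coeff : ∀ {m} → Poly m → Mon m → Carrier
  coeff []             e = 0#
  coeff ((a , e′) ∷ p) e with ≡-dec ℕ._≟_ e′ e
  ... | yes _ = a + coeff p e
  ... | no  _ = coeff p e

  _≈ₚ_ : ∀ {m} → Poly m → Poly m → Set ℓ
  p ≈ₚ r = ∀ e → coeff p e ≈ coeff r e

  const : ∀ {m} → Carrier → Poly m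
  const {m} a = (a , replicate m 0) ∷ []

  monomial : ∀ {m} → Mon m → Poly m
  monomial u = (1# , u) ∷ []

  var : ∀ {m} → Fin m → Poly m
  var {m} i = monomial (updateAt (replicate m 0) i (λ _ → 1))

  _+ₚ_ : ∀ {m} → Poly m → Poly m → Poly m
  _+ₚ_ = _++_

  -ₚ_ : ∀ {m} → Poly m → Poly m
  -ₚ_ = map (λ { (a , e) → (- a , e) })

  _-ₚ_ : ∀ {m} → Poly m → Poly m → Poly m
  p -ₚ r = p +ₚ (-ₚ r)

  _*ₚ_ : ∀ {m} → Poly m → Poly m → Poly m
  p *ₚ r = concatMap (λ { (a , e) → map (λ { (b , f) → (a * b , zipWith ℕ._+_ e f) }) r }) p

  _^ₚ_ : ∀ {m} → Poly m → ℕ → Poly m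
  p ^ₚ zero  = const 1#
  p ^ₚ suc n = p *ₚ (p ^ₚ n)

  ∑ₚ : ∀ {m n} → (Fin n → Poly m) → Poly m
  ∑ₚ {n = n} f = foldr (λ i acc → f i +ₚ acc) [] (allFin n)

  ∏ₚ : ∀ {m} → List (Poly m) → Poly m
  ∏ₚ = foldr _*ₚ_ (const 1#)

  substₚ : ∀ {m n} → (Fin m → Poly n) → Poly m → Poly n
  substₚ {m} σ [] = []
  substₚ {m} σ ((a , e) ∷ p) =
    (const a *ₚ ∏ₚ (map (λ i → σ i ^ₚ lookup e i) (allFin m))) +ₚ substₚ σ p

  Point : ℕ → Set c
  Point m = Fin m → Carrier

  _∈ₗ_ : Carrier → List Carrier → Set (c ⊔ ℓ)
  x ∈ₗ xs = Any (x ≈_) xs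

  _∈𝒜_ : ∀ {m} → Point m → (Fin m → List Carrier) → Set (c ⊔ ℓ)
  P ∈𝒜 As = ∀ i → P i ∈ₗ As i

  gen : ∀ {m} → (Fin m → List Carrier) → Fin m → Poly m
  gen As j = ∏ₚ (map (λ α → var j -ₚ const α) (As j))

  _∈I[_] : ∀ {m} → Poly m → (Fin m → List Carrier) → Set (c ⊔ ℓ)
  g ∈I[ As ] = ∃ λ (h : Fin _ → Poly _) → g ≈ₚ ∑ₚ (λ j → h j *ₚ gen As j)

  InSpan : ∀ {m} {ℓL : Level} → Pred (Mon m) ℓL → Poly m → Set (ℓ ⊔ ℓL)
  InSpan L h = ∀ e → ¬ (coeff h e ≈ 0#) → L e

  -- the normal form of g lies in Span(L); since Span(L) ⊆ Span(Δ) and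
  -- the normal form is the unique element of Span(Δ) congruent to g
  -- mod I_A, this is: some h ∈ Span(L) has g - h ∈ I_A.
  -- (Used together with L ⊆ Δ.)
  NormalFormInSpan : ∀ {m} {ℓL : Level} → (Fin m → List Carrier) →
                     Pred (Mon m) ℓL → Poly m → Set (c ⊔ ℓ ⊔ ℓL)
  NormalFormInSpan As L g = ∃ λ h → InSpan L h × ((g -ₚ h) ∈I[ As ])

  Matrix : ℕ → ℕ → Set c
  Matrix r s = Fin r → Fin s → Carrier

  actPoint : ∀ {m} → Matrix m m → Point m → Point m → Point m
  actPoint A b P i = ∑ (λ j → A i j * P j) + b i

  actPoly : ∀ {m} → Matrix m m → Point m → Poly m → Poly m
  actPoly A b = substₚ (λ i → ∑ₚ (λ j → const (A i j) *ₚ var j) +ₚ const (b i))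

  MapsOnto : ∀ {m} → Matrix m m → Point m → (Fin m → List Carrier) → Set (c ⊔ ℓ)
  MapsOnto A b As =
    (∀ P → P ∈𝒜 As → actPoint A b P ∈𝒜 As) ×
    (∀ P → P ∈𝒜 As → ∃ λ Q → Q ∈𝒜 As × (∀ i → actPoint A b Q i ≈ P i))

  InPermA : ∀ {m} {ℓL : Level} → (Fin m → List Carrier) → Pred (Mon m) ℓL →
            Matrix m m → Point m → Set (c ⊔ ℓ ⊔ ℓL)
  InPermA As L A b =
    MapsOnto A b As × (∀ u → L u → NormalFormInSpan As L (actPoly A b (monomial u)))

  ClosedUnderDivisibility : ∀ {m} {ℓL : Level} → Pred (Mon m) ℓL → Set ℓL
  ClosedUnderDivisibility {m} L =
    ∀ u v → L u → (∀ i → lookup v i ≤ lookup u i) → L v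

  Borel : ∀ {m} {ℓL : Level} → Pred (Mon m) ℓL → Set ℓL
  Borel {m} L = ∀ u (i j : Fin m) → L u → 1 ≤ lookup u i → toℕ j < toℕ i →
    L (updateAt (updateAt u i (λ d → d ∸ 1)) j suc)

  identity : ∀ {n} → Matrix n n
  identity i j with i ≟ᶠ j
  ... | yes _ = 1#
  ... | no  _ = 0#

  _·_ : ∀ {n} → Matrix n n → Matrix n n → Matrix n n
  (A · B) i k = ∑ (λ j → A i j * B j k)

  Nonsingular : ∀ {n} → Matrix n n → Set (c ⊔ ℓ)
  Nonsingular A = ∃ λ B → (∀ i j → (A · B) i j ≈ identity i j) ×
                          (∀ i j → (B · A) i j ≈ identity i j)

  LowerTriangular : ∀ {n} → Matrix n n → Set ℓ
  LowerTriangular A = ∀ i j → toℕ i < toℕ j → A i j ≈ 0#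

  blockDiag : ∀ {s} k → Matrix s s → Matrix (s ℕ.+ k) (s ℕ.+ k)
  blockDiag {s} k A₁ i j with splitAt s i | splitAt s j
  ... | inj₁ a | inj₁ b = A₁ a b
  ... | inj₂ a | inj₂ b = identity a b
  ... | _      | _      = 0#

  Fq : List Carrier
  Fq = map enum (allFin q)

  Fq* : List Carrier
  Fq* = filter (λ x → ¬? (x ≟ 0#)) Fq
    where open import Relation.Nullary using (¬?)

  𝒜sk : ∀ s k → Fin (s ℕ.+ k) → List Carrier
  𝒜sk s k i with splitAt s i
  ... | inj₁ _ = Fq
  ... | inj₂ _ = Fq*

  InΔsk : ∀ s k → Mon (s ℕ.+ k) → Set
  InΔsk s k u = ∀ i → Bound i (lookup u i)
    where
    Bound : Fin (s ℕ.+ k) → ℕ → Set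
    Bound i d with splitAt s i
    ... | inj₁ _ = d < q
    ... | inj₂ _ = d < q ∸ 1

{-# OPTIONS --safe #-}
-- Membership of a point in F_q^s × (F_q^*)^k only constrains its last k coordinates; T fixes
-- those and acts on the first s by the invertible map y ↦ A₁ y + b, so T permutes 𝒜.
--
-- For the span condition write e ≼ v when, for every monomial x^w x^v in L, also x^w x^e is in L.
-- Closure under divisibility gives 0 ≼ v, the Borel property gives x_j ≼ x_i for j ≤ i, and ≼ is
-- compatible with products. Lower triangularity makes every monomial of T(x_i) equal to 1 or to
-- some x_j with j ≤ i, so every monomial e of T(u) = ∏ T(x_i)^(u_i) has e ≼ u and hence lies in
-- L: T(u) is already in Span(L).
module Submission where

open import Defs
open import Level using (Level; _⊔_)
open import Data.Nat using (ℕ; _≤_)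
open import Data.List using (length)
open import Data.Fin using (Fin; _↑ʳ_)
open import Relation.Unary using (Pred)

open import Data.Nat as ℕ using (zero; suc; _<_; _∸_)
import Data.Nat.Properties as ℕₚ
open import Data.Fin as Fin using (toℕ; _↑ˡ_)
open import Data.Fin.Properties using (splitAt-↑ˡ; splitAt-↑ʳ; toℕ-↑ˡ; toℕ-↑ʳ; toℕ<n; toℕ-injective)
  renaming (_≟_ to _≟ᶠ_)
open import Data.List as List using (List; []; _∷_; allFin; tabulate)
open import Data.List.Relation.Unary.All as All using (All; []; _∷_)
import Data.List.Relation.Unary.All.Properties as All
import Data.List.Relation.Unary.Any as Any
import Data.List.Relation.Unary.Any.Properties as Any
open import Data.List.Membership.Propositional.Properties using (∈-allFin)
open import Data.Vec.Functional using () renaming (_++_ to _++ᵛ_)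
open import Data.Vec.Functional.Properties using (lookup-++ˡ; lookup-++ʳ)
open import Data.Vec as Vec using (Vec; zipWith; replicate; updateAt; lookup)
import Data.Vec.Properties as Vecₚ
open import Data.Product using (∃; _×_; _,_; proj₁; proj₂)
open import Data.Empty using (⊥-elim)
open import Function using (_∘_; id)
open import Relation.Nullary using (¬_; yes; no)
open import Relation.Binary.PropositionalEquality as ≡ using (_≡_; _≢_)

infixl 6 _⊕_
infixr 7 _•_

_⊕_ : ∀ {n} → Vec ℕ n → Vec ℕ n → Vec ℕ n
_⊕_ = zipWith ℕ._+_

0ᵛ : ∀ {n} → Vec ℕ n
0ᵛ {n} = replicate n 0

basis : ∀ {n} → Fin n → Vec ℕ n
basis {n} i = updateAt (replicate n 0) i (λ _ → 1)

_•_ : ∀ {n} → ℕ → Vec ℕ n → Vec ℕ n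
zero  • v = 0ᵛ
suc t • v = v ⊕ t • v

basisSum : ∀ {n} → Vec ℕ n → List (Fin n) → Vec ℕ n
basisSum u []       = 0ᵛ
basisSum u (i ∷ is) = lookup u i • basis i ⊕ basisSum u is

⊕-assoc : ∀ {n} (x y z : Vec ℕ n) → (x ⊕ y) ⊕ z ≡ x ⊕ (y ⊕ z)
⊕-assoc = Vecₚ.zipWith-assoc ℕₚ.+-assoc

⊕-comm : ∀ {n} (x y : Vec ℕ n) → x ⊕ y ≡ y ⊕ x
⊕-comm = Vecₚ.zipWith-comm ℕₚ.+-comm

⊕-identityˡ : ∀ {n} (x : Vec ℕ n) → 0ᵛ ⊕ x ≡ x
⊕-identityˡ = Vecₚ.zipWith-identityˡ ℕₚ.+-identityˡ

⊕-identityʳ : ∀ {n} (x : Vec ℕ n) → x ⊕ 0ᵛ ≡ x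
⊕-identityʳ = Vecₚ.zipWith-identityʳ ℕₚ.+-identityʳ

⊕-basis : ∀ {n} (w : Vec ℕ n) i → w ⊕ basis i ≡ updateAt w i suc
⊕-basis (x Vec.∷ w) Fin.zero    = ≡.cong₂ Vec._∷_ (ℕₚ.+-comm x 1) (⊕-identityʳ w)
⊕-basis (x Vec.∷ w) (Fin.suc i) = ≡.cong₂ Vec._∷_ (ℕₚ.+-identityʳ x) (⊕-basis w i)

•-0∷ : ∀ {n} t (v : Vec ℕ n) → t • (0 Vec.∷ v) ≡ 0 Vec.∷ t • v
•-0∷ zero    v = ≡.refl
•-0∷ (suc t) v = ≡.cong ((0 Vec.∷ v) ⊕_) (•-0∷ t v)

•-basis-zero : ∀ {n} t → t • basis {suc n} Fin.zero ≡ t Vec.∷ 0ᵛ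
•-basis-zero zero    = ≡.refl
•-basis-zero (suc t) = ≡.trans (≡.cong (basis Fin.zero ⊕_) (•-basis-zero t))
                               (≡.cong (suc t Vec.∷_) (⊕-identityˡ 0ᵛ))

basisSum-suc : ∀ {n p} x (u : Vec ℕ n) (g : Fin p → Fin n) →
               basisSum (x Vec.∷ u) (tabulate (Fin.suc ∘ g)) ≡ 0 Vec.∷ basisSum u (tabulate g)
basisSum-suc {p = zero}  x u g = ≡.refl
basisSum-suc {p = suc p} x u g =
  ≡.cong₂ _⊕_ (•-0∷ (lookup u (g Fin.zero)) (basis (g Fin.zero))) (basisSum-suc x u (g ∘ Fin.suc))

basisSum-allFin : ∀ {n} (u : Vec ℕ n) → basisSum u (allFin n) ≡ u
basisSum-allFin Vec.[]      = ≡.refl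
basisSum-allFin (x Vec.∷ u) =
  ≡.trans (≡.cong₂ _⊕_ (•-basis-zero x) (basisSum-suc x u id))
          (≡.cong₂ Vec._∷_ (ℕₚ.+-identityʳ x) (≡.trans (⊕-identityˡ _) (basisSum-allFin u)))

lookup-⊕-basis : ∀ {n} (w : Vec ℕ n) i → lookup (w ⊕ basis i) i ≡ suc (lookup w i)
lookup-⊕-basis w i = ≡.trans (≡.cong (λ v → lookup v i) (⊕-basis w i)) (Vecₚ.lookup∘updateAt i w)

updateAt-moveUnit : ∀ {n} (w : Vec ℕ n) i j →
                    updateAt (updateAt (w ⊕ basis i) i (_∸ 1)) j suc ≡ w ⊕ basis j
updateAt-moveUnit w i j = begin
  updateAt (updateAt (w ⊕ basis i) i (_∸ 1)) j suc
    ≡⟨ ≡.cong (λ v → updateAt (updateAt v i (_∸ 1)) j suc) (⊕-basis w i) ⟩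
  updateAt (updateAt (updateAt w i suc) i (_∸ 1)) j suc
    ≡⟨ ≡.cong (λ v → updateAt v j suc) (Vecₚ.updateAt-updateAt i w) ⟩
  updateAt (updateAt w i id) j suc
    ≡⟨ ≡.cong (λ v → updateAt v j suc) (Vecₚ.updateAt-id i w) ⟩
  updateAt w j suc
    ≡⟨ ⊕-basis w j ⟨
  w ⊕ basis j ∎
  where open ≡.≡-Reasoning

data BlockView (s k : ℕ) : Fin (s ℕ.+ k) → Set where
  top    : ∀ a → BlockView s k (a ↑ˡ k)
  bottom : ∀ c → BlockView s k (s ↑ʳ c)

blockView : ∀ s k i → BlockView s k i
blockView zero    k i           = bottom i
blockView (suc s) k Fin.zero    = top Fin.zero
blockView (suc s) k (Fin.suc i) with blockView s k i
... | top a    = top (Fin.suc a)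
... | bottom c = bottom c

module _ {c ℓ : Level} (F : FiniteField c ℓ) where
  open FiniteField F hiding (zero)
  open Over F
  open import Algebra.Properties.Semiring.Sum semiring
    using (sum; sum-cong-≋; sum-cong-≗; sum-replicate-zero; ∑-comm; *-distribˡ-sum; *-distribʳ-sum)
  open import Algebra.Properties.Ring ring using (-0#≈0#; -‿+-comm)
  open import Algebra.Properties.Group +-group using (//-rightDividesˡ)
  open import Relation.Binary.Reasoning.Setoid setoid

  module Dominance {m ℓL} (L : Pred (Mon m) ℓL) where

    infix 4 _≼_
    _≼_ : Mon m → Mon m → Set ℓL
    e ≼ v = ∀ w → L (w ⊕ v) → L (w ⊕ e)

    ≼-refl : ∀ {v} → v ≼ v
    ≼-refl w = id

    ≼-⊕ : ∀ {e₁ e₂ v₁ v₂} → e₁ ≼ v₁ → e₂ ≼ v₂ → e₁ ⊕ e₂ ≼ v₁ ⊕ v₂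
    ≼-⊕ {e₁} {e₂} {v₁} {v₂} e₁≼v₁ e₂≼v₂ w =
      ≡.subst L (⊕-assoc w e₁ e₂)
      ∘ e₂≼v₂ (w ⊕ e₁)
      ∘ ≡.subst L (swap w v₂ e₁)
      ∘ e₁≼v₁ (w ⊕ v₂)
      ∘ ≡.subst L (≡.trans (≡.sym (⊕-assoc w v₁ v₂)) (swap w v₁ v₂))
      where
      swap : ∀ x y z → x ⊕ y ⊕ z ≡ x ⊕ z ⊕ y
      swap x y z = ≡.trans (⊕-assoc x y z)
                   (≡.trans (≡.cong (x ⊕_) (⊕-comm y z)) (≡.sym (⊕-assoc x z y)))

    0ᵛ≼ : ClosedUnderDivisibility L → ∀ v → 0ᵛ ≼ v
    0ᵛ≼ closed v w w⊕v∈L = ≡.subst L (≡.sym (⊕-identityʳ w)) (closed (w ⊕ v) w w⊕v∈L w≤w⊕v)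
      where
      w≤w⊕v : ∀ i → lookup w i ≤ lookup (w ⊕ v) i
      w≤w⊕v i = ≡.subst (lookup w i ≤_) (≡.sym (Vecₚ.lookup-zipWith ℕ._+_ i w v)) (ℕₚ.m≤m+n _ _)

    basis≼basis : Borel L → ∀ {i j} → toℕ j ≤ toℕ i → basis j ≼ basis i
    basis≼basis borel {i} {j} j≤i w w⊕eᵢ∈L with toℕ j ℕ.≟ toℕ i
    ... | yes j≡i rewrite toℕ-injective j≡i = w⊕eᵢ∈L
    ... | no  j≢i = ≡.subst L (updateAt-moveUnit w i j)
                      (borel (w ⊕ basis i) i j w⊕eᵢ∈L xᵢ∣w⊕eᵢ (ℕₚ.≤∧≢⇒< j≤i j≢i))
      where
      xᵢ∣w⊕eᵢ : 1 ≤ lookup (w ⊕ basis i) i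
      xᵢ∣w⊕eᵢ = ≡.subst (1 ≤_) (≡.sym (lookup-⊕-basis w i)) (ℕ.s≤s ℕ.z≤n)

    Dominated : Mon m → Poly m → Set (c ⊔ ℓ ⊔ ℓL)
    Dominated v = All (λ t → ¬ (proj₁ t ≈ 0#) → proj₂ t ≼ v)

    coeff≉0⇒≼ : ∀ {v} p e → Dominated v p → ¬ (coeff p e ≈ 0#) → e ≼ v
    coeff≉0⇒≼ []             e []               coeff≉0 = ⊥-elim (coeff≉0 refl)
    coeff≉0⇒≼ ((a , e′) ∷ p) e (a≉0⇒e′≼v ∷ dom) coeff≉0 with Vecₚ.≡-dec ℕ._≟_ e′ e
    ... | no  _      = coeff≉0⇒≼ p e dom coeff≉0
    ... | yes ≡.refl with a ≟ 0#
    ...   | no  a≉0 = a≉0⇒e′≼v a≉0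
    ...   | yes a≈0 = coeff≉0⇒≼ p e dom (λ c≈0 → coeff≉0 (trans (+-cong a≈0 c≈0) (+-identityˡ 0#)))

    dominated⇒inSpan : ∀ {u p} → L u → Dominated u p → InSpan L p
    dominated⇒inSpan {u} {p} u∈L dom e coeff≉0 =
      ≡.subst L (⊕-identityˡ e) (coeff≉0⇒≼ p e dom coeff≉0 0ᵛ (≡.subst L (≡.sym (⊕-identityˡ u)) u∈L))

    Dominated-const : ∀ a → Dominated 0ᵛ (const a)
    Dominated-const a = (λ _ → ≼-refl) ∷ []

    Dominated-*ₚ : ∀ {v₁ v₂ p r} → Dominated v₁ p → Dominated v₂ r → Dominated (v₁ ⊕ v₂) (p *ₚ r)
    Dominated-*ₚ dom-p dom-r =
      All.concat⁺ (All.map⁺ (All.map (λ dom-a → All.map⁺ (All.map (λ dom-b ab≉0 →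
        ≼-⊕ (dom-a (λ a≈0 → ab≉0 (trans (*-congʳ a≈0) (zeroˡ _))))
            (dom-b (λ b≈0 → ab≉0 (trans (*-congˡ b≈0) (zeroʳ _)))))
          dom-r)) dom-p))

    Dominated-^ₚ : ∀ {v p} → Dominated v p → ∀ t → Dominated (t • v) (p ^ₚ t)
    Dominated-^ₚ dom zero    = Dominated-const 1#
    Dominated-^ₚ dom (suc t) = Dominated-*ₚ dom (Dominated-^ₚ dom t)

    Dominated-∏ₚ : ∀ (σ : Fin m → Poly m) → (∀ i → Dominated (basis i) (σ i)) →
                   ∀ u is → Dominated (basisSum u is) (∏ₚ (List.map (λ i → σ i ^ₚ lookup u i) is))
    Dominated-∏ₚ σ dom u []       = Dominated-const 1#
    Dominated-∏ₚ σ dom u (i ∷ is) =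
      Dominated-*ₚ (Dominated-^ₚ (dom i) (lookup u i)) (Dominated-∏ₚ σ dom u is)

    Dominated-∑ₚ : ∀ {n v} (f : Fin n → Poly m) → (∀ j → Dominated v (f j)) → Dominated v (∑ₚ f)
    Dominated-∑ₚ {n} {v} f dom = go (allFin n)
      where
      go : ∀ js → Dominated v (List.foldr (λ j acc → f j +ₚ acc) [] js)
      go []       = []
      go (j ∷ js) = All.++⁺ (dom j) (go js)

    Dominated-affineImageOfVar : ClosedUnderDivisibility L → Borel L →
                            ∀ {A : Matrix m m} → LowerTriangular A → (b : Point m) (i : Fin m) →
                            Dominated (basis i) (∑ₚ (λ j → const (A i j) *ₚ var j) +ₚ const (b i))
    Dominated-affineImageOfVar closed borel {A} lower b i =
      All.++⁺ (Dominated-∑ₚ (λ j → const (A i j) *ₚ var j) linear) ((λ _ → 0ᵛ≼ closed (basis i)) ∷ [])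
      where
      linear : ∀ j → Dominated (basis i) (const (A i j) *ₚ var j)
      linear j = (λ Aᵢⱼ≉0 → ≡.subst (_≼ basis i) (≡.sym (⊕-identityˡ (basis j)))
                   (basis≼basis borel (ℕₚ.≮⇒≥ (λ i<j → Aᵢⱼ≉0 (trans (*-identityʳ _) (lower i j i<j))))))
                 ∷ []

    actPoly-monomial-inSpan : ClosedUnderDivisibility L → Borel L →
                              ∀ {A : Matrix m m} → LowerTriangular A → (b : Point m) (u : Mon m) → L u →
                              InSpan L (actPoly A b (monomial u))
    actPoly-monomial-inSpan closed borel {A} lower b u u∈L = dominated⇒inSpan u∈L
      (≡.subst (λ v → Dominated v (actPoly A b (monomial u)))
               (≡.trans (⊕-identityˡ _) (basisSum-allFin u))
               (All.++⁺ (Dominated-*ₚ (Dominated-const 1#)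
                          (Dominated-∏ₚ _ (Dominated-affineImageOfVar closed borel lower b) u (allFin m)))
                        []))

  coeff-+ₚ : ∀ {m} (p r : Poly m) e → coeff (p +ₚ r) e ≈ coeff p e + coeff r e
  coeff-+ₚ []             r e = sym (+-identityˡ _)
  coeff-+ₚ ((a , e′) ∷ p) r e with Vecₚ.≡-dec ℕ._≟_ e′ e
  ... | yes _ = trans (+-congˡ (coeff-+ₚ p r e)) (sym (+-assoc _ _ _))
  ... | no  _ = coeff-+ₚ p r e

  coeff-negₚ : ∀ {m} (p : Poly m) e → coeff (-ₚ p) e ≈ - coeff p e
  coeff-negₚ []             e = sym -0#≈0#
  coeff-negₚ ((a , e′) ∷ p) e with Vecₚ.≡-dec ℕ._≟_ e′ e
  ... | yes _ = trans (+-congˡ (coeff-negₚ p e)) (-‿+-comm a (coeff p e))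
  ... | no  _ = coeff-negₚ p e

  ∑ₚ-[] : ∀ {m n} → ∑ₚ {m} {n} (λ _ → []) ≡ []
  ∑ₚ-[] {n = n} = go (allFin n)
    where
    go : ∀ js → List.foldr (λ _ acc → acc) [] js ≡ []
    go []       = ≡.refl
    go (_ ∷ js) = go js

  p-p∈I : ∀ {m} (As : Fin m → List Carrier) p → (p -ₚ p) ∈I[ As ]
  p-p∈I {m} As p = (λ _ → []) , λ e → begin
    coeff (p -ₚ p) e            ≈⟨ coeff-+ₚ p (-ₚ p) e ⟩
    coeff p e + coeff (-ₚ p) e  ≈⟨ +-congˡ (coeff-negₚ p e) ⟩
    coeff p e - coeff p e       ≈⟨ -‿inverseʳ _ ⟩
    0#                          ≡⟨ ≡.cong (λ r → coeff r e) (∑ₚ-[] {n = m}) ⟨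
    coeff (∑ₚ (λ j → [] *ₚ gen As j)) e ∎

  -- NormalFormInSpan only asks for a representative of g modulo I_A, so g is its own witness.
  inSpan⇒normalFormInSpan : ∀ {m ℓL} (As : Fin m → List Carrier) {L : Pred (Mon m) ℓL} g →
                            InSpan L g → NormalFormInSpan As L g
  inSpan⇒normalFormInSpan As g g∈L = g , g∈L , p-p∈I As g

  ∑≡sum : ∀ {n} (f : Fin n → Carrier) → ∑ f ≡ sum f
  ∑≡sum {n} f = go id
    where
    go : ∀ {p} (g : Fin p → Fin n) → List.foldr (λ i acc → f i + acc) 0# (tabulate g) ≡ sum (f ∘ g)
    go {zero}  g = ≡.refl
    go {suc p} g = ≡.cong (f (g Fin.zero) +_) (go (g ∘ Fin.suc))

  ∑-cong : ∀ {n} {f g : Fin n → Carrier} → (∀ i → f i ≈ g i) → ∑ f ≈ ∑ g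
  ∑-cong {f = f} {g} f≈g = begin
    ∑ f   ≡⟨ ∑≡sum f ⟩
    sum f ≈⟨ sum-cong-≋ f≈g ⟩
    sum g ≡⟨ ∑≡sum g ⟨
    ∑ g   ∎

  sum-zero : ∀ {n} {f : Fin n → Carrier} → (∀ i → f i ≈ 0#) → sum f ≈ 0#
  sum-zero {n} f≈0 = trans (sum-cong-≋ f≈0) (sum-replicate-zero n)

  sum-↑ˡ-↑ʳ : ∀ s k (f : Fin (s ℕ.+ k) → Carrier) →
              sum f ≈ sum (λ a → f (a ↑ˡ k)) + sum (λ c → f (s ↑ʳ c))
  sum-↑ˡ-↑ʳ zero    k f = sym (+-identityˡ _)
  sum-↑ˡ-↑ʳ (suc s) k f = trans (+-congˡ (sum-↑ˡ-↑ʳ s k (f ∘ Fin.suc))) (sym (+-assoc _ _ _))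

  identity-suc : ∀ {n} (i j : Fin n) → identity (Fin.suc i) (Fin.suc j) ≡ identity i j
  identity-suc i j with i ≟ᶠ j
  ... | yes ≡.refl = ≡.refl
  ... | no  _      = ≡.refl

  identity-≢ : ∀ {n} {i j : Fin n} → i ≢ j → identity i j ≡ 0#
  identity-≢ {i = i} {j} i≢j with i ≟ᶠ j
  ... | yes i≡j = ⊥-elim (i≢j i≡j)
  ... | no  _   = ≡.refl

  sum-identity-* : ∀ {n} (i : Fin n) (f : Fin n → Carrier) → sum (λ j → identity i j * f j) ≈ f i
  sum-identity-* Fin.zero    f = begin
    1# * f Fin.zero + sum (λ j → 0# * f (Fin.suc j))
      ≈⟨ +-cong (*-identityˡ _) (sum-zero (λ j → zeroˡ (f (Fin.suc j)))) ⟩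
    f Fin.zero + 0#                                  ≈⟨ +-identityʳ _ ⟩
    f Fin.zero                                       ∎
  sum-identity-* (Fin.suc i) f = begin
    0# * f Fin.zero + sum (λ j → identity (Fin.suc i) (Fin.suc j) * f (Fin.suc j))
      ≈⟨ +-cong (zeroˡ _) (sum-cong-≋ (λ j → *-congʳ (reflexive (identity-suc i j)))) ⟩
    0# + sum (λ j → identity i j * f (Fin.suc j)) ≈⟨ +-identityˡ _ ⟩
    sum (λ j → identity i j * f (Fin.suc j))      ≈⟨ sum-identity-* i (f ∘ Fin.suc) ⟩
    f (Fin.suc i)                                 ∎

  rightInverse-cancel : ∀ {n} {A B : Matrix n n} → (∀ i j → (A · B) i j ≈ identity i j) →
                        ∀ (z : Point n) i → ∑ (λ j → A i j * ∑ (λ c → B j c * z c)) ≈ z i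
  rightInverse-cancel {n} {A} {B} AB≈I z i = begin
    ∑ (λ j → A i j * ∑ (λ c → B j c * z c))
      ≡⟨ ∑≡sum (λ j → A i j * ∑ (λ c → B j c * z c)) ⟩
    sum (λ j → A i j * ∑ (λ c → B j c * z c))
      ≡⟨ sum-cong-≗ (λ j → ≡.cong (A i j *_) (∑≡sum (λ c → B j c * z c))) ⟩
    sum (λ j → A i j * sum (λ c → B j c * z c))
      ≈⟨ sum-cong-≋ (λ j → *-distribˡ-sum (A i j) (λ c → B j c * z c)) ⟩
    sum (λ j → sum (λ c → A i j * (B j c * z c)))     ≈⟨ ∑-comm (λ j c → A i j * (B j c * z c)) ⟩
    sum (λ c → sum (λ j → A i j * (B j c * z c)))
      ≈⟨ sum-cong-≋ (λ c → trans (sum-cong-≋ {n} (λ j → sym (*-assoc (A i j) (B j c) (z c))))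
                                 (sym (*-distribʳ-sum (z c) (λ j → A i j * B j c)))) ⟩
    sum (λ c → sum (λ j → A i j * B j c) * z c)
      ≈⟨ sum-cong-≋ (λ c → *-congʳ (trans (reflexive (≡.sym (∑≡sum (λ j → A i j * B j c))))
                                          (AB≈I i c))) ⟩
    sum (λ c → identity i c * z c)                    ≈⟨ sum-identity-* i z ⟩
    z i                                               ∎

  ∈Fq : ∀ x → x ∈ₗ Fq
  ∈Fq x = Any.map⁺ (Any.map (λ { ≡.refl → sym (proj₂ (enum-sur x) ≡.refl) })
                             (∈-allFin (proj₁ (enum-sur x))))

  ∈ₗ-resp-≈ : ∀ {x y xs} → x ≈ y → y ∈ₗ xs → x ∈ₗ xs
  ∈ₗ-resp-≈ x≈y = Any.map (trans x≈y)

  ∈𝒜sk-byBottom : ∀ {s k} {P : Point (s ℕ.+ k)} →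
                  (∀ c → P (s ↑ʳ c) ∈ₗ 𝒜sk s k (s ↑ʳ c)) → P ∈𝒜 𝒜sk s k
  ∈𝒜sk-byBottom {s} {k} {P} bottom∈ i with blockView s k i
  ... | top a    rewrite splitAt-↑ˡ s a k = ∈Fq (P (a ↑ˡ k))
  ... | bottom c = bottom∈ c

  module _ {s : ℕ} (k : ℕ) (A₁ : Matrix s s) where

    blockDiag-↑ˡ↑ˡ : ∀ a a′ → blockDiag k A₁ (a ↑ˡ k) (a′ ↑ˡ k) ≡ A₁ a a′
    blockDiag-↑ˡ↑ˡ a a′ rewrite splitAt-↑ˡ s a k | splitAt-↑ˡ s a′ k = ≡.refl

    blockDiag-↑ˡ↑ʳ : ∀ a c → blockDiag k A₁ (a ↑ˡ k) (s ↑ʳ c) ≡ 0#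
    blockDiag-↑ˡ↑ʳ a c rewrite splitAt-↑ˡ s a k | splitAt-↑ʳ s k c = ≡.refl

    blockDiag-↑ʳ↑ˡ : ∀ c a → blockDiag k A₁ (s ↑ʳ c) (a ↑ˡ k) ≡ 0#
    blockDiag-↑ʳ↑ˡ c a rewrite splitAt-↑ˡ s a k | splitAt-↑ʳ s k c = ≡.refl

    blockDiag-↑ʳ↑ʳ : ∀ c c′ → blockDiag k A₁ (s ↑ʳ c) (s ↑ʳ c′) ≡ identity c c′
    blockDiag-↑ʳ↑ʳ c c′ rewrite splitAt-↑ʳ s k c | splitAt-↑ʳ s k c′ = ≡.refl

    blockDiag-lowerTriangular : LowerTriangular A₁ → LowerTriangular (blockDiag k A₁)
    blockDiag-lowerTriangular lower i j i<j with blockView s k i | blockView s k j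
    ... | top a    | top a′    = trans (reflexive (blockDiag-↑ˡ↑ˡ a a′))
                                       (lower a a′ (≡.subst₂ _<_ (toℕ-↑ˡ a k) (toℕ-↑ˡ a′ k) i<j))
    ... | top a    | bottom c′ = reflexive (blockDiag-↑ˡ↑ʳ a c′)
    ... | bottom c | top a′    = ⊥-elim (ℕₚ.≤⇒≯ (ℕₚ.m≤m+n s (toℕ c))
                                   (ℕₚ.<-trans (≡.subst₂ _<_ (toℕ-↑ʳ s c) (toℕ-↑ˡ a′ k) i<j) (toℕ<n a′)))
    ... | bottom c | bottom c′ = reflexive (≡.trans (blockDiag-↑ʳ↑ʳ c c′)
                                   (identity-≢ (λ c≡c′ → ℕₚ.<-irrefl (≡.cong (toℕ ∘ (s ↑ʳ_)) c≡c′) i<j)))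

    blockDiag-row-↑ˡ : ∀ (P : Point (s ℕ.+ k)) a →
                       ∑ (λ j → blockDiag k A₁ (a ↑ˡ k) j * P j) ≈ ∑ (λ a′ → A₁ a a′ * P (a′ ↑ˡ k))
    blockDiag-row-↑ˡ P a = begin
      ∑ (λ j → blockDiag k A₁ (a ↑ˡ k) j * P j)
        ≡⟨ ∑≡sum (λ j → blockDiag k A₁ (a ↑ˡ k) j * P j) ⟩
      sum (λ j → blockDiag k A₁ (a ↑ˡ k) j * P j)
        ≈⟨ sum-↑ˡ-↑ʳ s k _ ⟩
      sum (λ a′ → blockDiag k A₁ (a ↑ˡ k) (a′ ↑ˡ k) * P (a′ ↑ˡ k))
        + sum (λ c → blockDiag k A₁ (a ↑ˡ k) (s ↑ʳ c) * P (s ↑ʳ c))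
        ≈⟨ +-cong (sum-cong-≋ (λ a′ → *-congʳ (reflexive (blockDiag-↑ˡ↑ˡ a a′))))
                  (sum-zero (λ c → trans (*-congʳ (reflexive (blockDiag-↑ˡ↑ʳ a c))) (zeroˡ _))) ⟩
      sum (λ a′ → A₁ a a′ * P (a′ ↑ˡ k)) + 0#
        ≈⟨ +-identityʳ _ ⟩
      sum (λ a′ → A₁ a a′ * P (a′ ↑ˡ k))
        ≡⟨ ∑≡sum (λ a′ → A₁ a a′ * P (a′ ↑ˡ k)) ⟨
      ∑ (λ a′ → A₁ a a′ * P (a′ ↑ˡ k)) ∎

    blockDiag-row-↑ʳ : ∀ (P : Point (s ℕ.+ k)) c → ∑ (λ j → blockDiag k A₁ (s ↑ʳ c) j * P j) ≈ P (s ↑ʳ c)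
    blockDiag-row-↑ʳ P c = begin
      ∑ (λ j → blockDiag k A₁ (s ↑ʳ c) j * P j)
        ≡⟨ ∑≡sum (λ j → blockDiag k A₁ (s ↑ʳ c) j * P j) ⟩
      sum (λ j → blockDiag k A₁ (s ↑ʳ c) j * P j)
        ≈⟨ sum-↑ˡ-↑ʳ s k _ ⟩
      sum (λ a′ → blockDiag k A₁ (s ↑ʳ c) (a′ ↑ˡ k) * P (a′ ↑ˡ k))
        + sum (λ c′ → blockDiag k A₁ (s ↑ʳ c) (s ↑ʳ c′) * P (s ↑ʳ c′))
        ≈⟨ +-cong (sum-zero (λ a′ → trans (*-congʳ (reflexive (blockDiag-↑ʳ↑ˡ c a′))) (zeroˡ _)))
                  (sum-cong-≋ (λ c′ → *-congʳ (reflexive (blockDiag-↑ʳ↑ʳ c c′)))) ⟩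
      0# + sum (λ c′ → identity c c′ * P (s ↑ʳ c′))
        ≈⟨ +-identityˡ _ ⟩
      sum (λ c′ → identity c c′ * P (s ↑ʳ c′))
        ≈⟨ sum-identity-* c _ ⟩
      P (s ↑ʳ c) ∎

    actPoint-blockDiag-↑ˡ : ∀ b (P : Point (s ℕ.+ k)) a →
      actPoint (blockDiag k A₁) b P (a ↑ˡ k) ≈ ∑ (λ a′ → A₁ a a′ * P (a′ ↑ˡ k)) + b (a ↑ˡ k)
    actPoint-blockDiag-↑ˡ b P a = +-congʳ (blockDiag-row-↑ˡ P a)

    actPoint-blockDiag-↑ʳ : ∀ b (P : Point (s ℕ.+ k)) c → b (s ↑ʳ c) ≈ 0# →
                            actPoint (blockDiag k A₁) b P (s ↑ʳ c) ≈ P (s ↑ʳ c)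
    actPoint-blockDiag-↑ʳ b P c b≈0 = trans (+-cong (blockDiag-row-↑ʳ P c) b≈0) (+-identityʳ _)

    actPoint-blockDiag-∈𝒜sk : ∀ {b} → (∀ c → b (s ↑ʳ c) ≈ 0#) →
                              ∀ P → P ∈𝒜 𝒜sk s k → actPoint (blockDiag k A₁) b P ∈𝒜 𝒜sk s k
    actPoint-blockDiag-∈𝒜sk {b} b↓≈0 P P∈𝒜 = ∈𝒜sk-byBottom (λ c →
      ∈ₗ-resp-≈ (actPoint-blockDiag-↑ʳ b P c (b↓≈0 c)) (P∈𝒜 (s ↑ʳ c)))

    actPoint-blockDiag-preimage : Nonsingular A₁ → ∀ {b} → (∀ c → b (s ↑ʳ c) ≈ 0#) →
      ∀ P → P ∈𝒜 𝒜sk s k → ∃ λ Q → Q ∈𝒜 𝒜sk s k × (∀ i → actPoint (blockDiag k A₁) b Q i ≈ P i)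
    actPoint-blockDiag-preimage (B , A₁B≈I , _) {b} b↓≈0 P P∈𝒜 = Q , Q∈𝒜 , TQ≈P
      where
      z : Point s
      z a = P (a ↑ˡ k) - b (a ↑ˡ k)
      y : Point s
      y a = ∑ (λ c → B a c * z c)
      P↓ : Point k
      P↓ c = P (s ↑ʳ c)
      Q : Point (s ℕ.+ k)
      Q = y ++ᵛ P↓
      Q∈𝒜 : Q ∈𝒜 𝒜sk s k
      Q∈𝒜 = ∈𝒜sk-byBottom (λ c → ∈ₗ-resp-≈ (reflexive (lookup-++ʳ y P↓ c)) (P∈𝒜 (s ↑ʳ c)))
      TQ≈P : ∀ i → actPoint (blockDiag k A₁) b Q i ≈ P i
      TQ≈P i with blockView s k i
      ... | bottom c = trans (actPoint-blockDiag-↑ʳ b Q c (b↓≈0 c)) (reflexive (lookup-++ʳ y P↓ c))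
      ... | top a    = begin
        actPoint (blockDiag k A₁) b Q (a ↑ˡ k)
          ≈⟨ actPoint-blockDiag-↑ˡ b Q a ⟩
        ∑ (λ a′ → A₁ a a′ * Q (a′ ↑ˡ k)) + b (a ↑ˡ k)
          ≈⟨ +-congʳ (∑-cong (λ a′ → *-congˡ (reflexive (lookup-++ˡ y P↓ a′)))) ⟩
        ∑ (λ a′ → A₁ a a′ * ∑ (λ c → B a′ c * z c)) + b (a ↑ˡ k)
          ≈⟨ +-congʳ (rightInverse-cancel A₁B≈I z a) ⟩
        z a + b (a ↑ˡ k)
          ≈⟨ //-rightDividesˡ (b (a ↑ˡ k)) (P (a ↑ˡ k)) ⟩
        P (a ↑ˡ k) ∎

    mapsOnto-blockDiag : Nonsingular A₁ → ∀ {b} → (∀ c → b (s ↑ʳ c) ≈ 0#) →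
                         MapsOnto (blockDiag k A₁) b (𝒜sk s k)
    mapsOnto-blockDiag nonsingular b↓≈0 =
      actPoint-blockDiag-∈𝒜sk b↓≈0 , actPoint-blockDiag-preimage nonsingular b↓≈0

corollary2 : ∀ {c ℓ ℓL : Level} (F : FiniteField c ℓ) (s k : ℕ) →
    let open FiniteField F
        open Over F
    in (∀ i → 2 ≤ length (𝒜sk s k i)) →
       (L : Pred (Mon (s Data.Nat.+ k)) ℓL) →
       (∀ u → L u → InΔsk s k u) →
       ClosedUnderDivisibility L →
       Borel L →
       (A₁ : Matrix s s) → LowerTriangular A₁ → Nonsingular A₁ →
       (b : Point (s Data.Nat.+ k)) → (∀ (i : Fin k) → b (s ↑ʳ i) ≈ 0#) →
       InPermA (𝒜sk s k) L (blockDiag k A₁) b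
corollary2 F s k _ L _ closed borel A₁ lower nonsingular b b↓≈0 =
  mapsOnto-blockDiag F k A₁ nonsingular b↓≈0 ,
  λ u u∈L → inSpan⇒normalFormInSpan F (𝒜sk s k) (actPoly (blockDiag k A₁) b (monomial u))
              (actPoly-monomial-inSpan closed borel (blockDiag-lowerTriangular F k A₁ lower) b u u∈L)
  where
  open Over F
  open Dominance F L
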